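{- Let $a,b$ be coprime positive integers and $0\le k<b$. Let $D$ be a $k$-stable chip configuration and $Q=\mathrm{lpath}(D)$. Then $D$ is not $k$-skeletal if and only if there exists $s\in\{1,\dots,b\}$ such that: $Q$ passes through the min-level point $v_s$ with the step ending at $v_s$ being an east step, $\beta_S$ is legal on $D$, and $\beta_S(D)$ is $k$-stable, where $S$ is the set of the $s$ poorest vertices of $D$.
   Context: Write $[b]=\{1,\dots,b\}$. A chip configuration is $D:[b]\to\mathbb{Z}$; $D\ge0$ means all values nonnegative. For $S\subseteq[b]$ with $|S|=s$, $\phi_S$ subtracts $1+\lfloor (b-s)a/b\rfloor$ from $D(i)$ for $i\in S$ and adds $\lfloor sa/b\rfloor$ to $D(j)$ for $j\in[b]\setminus S$; $\beta_S=\phi_S^{ -1}$. For $D\ge 0$ a move is legal if its result is $\ge0$. A $k$-firing move is $\phi_S$ with $0<|S|\le k+1$; $D\ge0$ is $k$-stable if no $k$-firing move is legal; $D$ is $k$-skeletal if it is $k$-stable and for every nonempty $T\subseteq[b]$ with $\beta_T$ legal on $D$, $\beta_T(D)$ is not $k$-stable. For $D\ge0$: $i$ is poorer than $j$ if $D(i)<D(j)$ or ($D(i)=D(j)$ and $i<j$); with $w_1,\dots,w_b$ the vertices from poorest to richest and $x_t=D(w_t)$, the $s$ poorest vertices are $w_1,\dots,w_s$, and $\mathrm{lpath}(D)$ is the lattice path from $(0,0)$ having, for each $t$, a north step from $(x_t,t-1)$ to $(x_t,t)$ labeled $w_t$, joined by east steps, ending with east steps to $(a,b)$ when $x_b\le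 a$. The min-level points are $v_s=(\lfloor sa/b\rfloor,s)$ for $1\le s\le b-1$ and $v_b=(a-1,b)$. -}

module Defs where

open import Data.Nat as ℕ using (ℕ; zero; suc; _∸_; NonZero; _<?_; _≤?_)
open import Data.Nat.DivMod using (_/_)
open import Data.Integer as ℤ using (ℤ; +_; ∣_∣)
import Data.Integer.Properties as ℤP
open import Data.Fin using (Fin)
import Data.Fin.Properties as FinP
open import Data.Fin.Subset using (Subset; Side; inside; outside)
import Data.Fin.Subset as Sub
open import Data.Vec using (lookup; tabulate)
open import Data.List using (List; []; _∷_; _++_; map; take; allFin)
open import Data.List.Membership.Propositional using (_∈_)
open import Data.Product using (_×_; _,_; proj₂)
open import Data.Product.Relation.Binary.Lex.NonStrict using (×-decTotalOrder)
open import Data.Bool using (if_then_else_)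
open import Relation.Nullary using (¬_; does)

-- Chip configurations on [b] = Fin b (vertex i ∈ Fin b stands for i+1).
Config : ℕ → Set
Config b = Fin b → ℤ

NonNeg : ∀ {b} → Config b → Set
NonNeg D = ∀ i → ℤ.0ℤ ℤ.≤ D i

φ : (a b : ℕ) .{{_ : NonZero b}} → Subset b → Config b → Config b
φ a b S D i with lookup S i
... | inside  = D i ℤ.- + (suc (((b ∸ Sub.∣ S ∣) ℕ.* a) / b))
... | outside = D i ℤ.+ + ((Sub.∣ S ∣ ℕ.* a) / b)

β : (a b : ℕ) .{{_ : NonZero b}} → Subset b → Config b → Config b
β a b S D i with lookup S i
... | inside  = D i ℤ.+ + (suc (((b ∸ Sub.∣ S ∣) ℕ.* a) / b))
... | outside = D i ℤ.- + ((Sub.∣ S ∣ ℕ.* a) / b)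

-- For D ≥ 0, a move M is legal on D iff M(D) ≥ 0.

KStable : (a b : ℕ) .{{_ : NonZero b}} → ℕ → Config b → Set
KStable a b k D =
  NonNeg D ×
  (∀ (S : Subset b) → 0 ℕ.< Sub.∣ S ∣ → Sub.∣ S ∣ ℕ.≤ suc k → ¬ NonNeg (φ a b S D))

KSkeletal : (a b : ℕ) .{{_ : NonZero b}} → ℕ → Config b → Set
KSkeletal a b k D =
  KStable a b k D ×
  (∀ (T : Subset b) → 0 ℕ.< Sub.∣ T ∣ → NonNeg (β a b T D) → ¬ KStable a b k (β a b T D))

lexOrder : ℕ → _
lexOrder b = ×-decTotalOrder ℤP.≤-decTotalOrder (FinP.≤-decTotalOrder b)

poorToRich : ∀ {b} → Config b → List (Fin b)
poorToRich {b} D = map proj₂ (sort (map (λ i → (D i , i)) (allFin b)))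
  where open import Data.List.Sort (lexOrder b) using (sort)

poorest : ∀ {b} → ℕ → Config b → Subset b
poorest {b} s D = tabulate (λ i → if does (i ∈? take s (poorToRich D)) then inside else outside)
  where open import Data.List.Membership.DecPropositional (FinP._≟_ {b}) using (_∈?_)

-- Lattice paths: each step is recorded together with the lattice point where it ends.
data Step (b : ℕ) : Set where
  north : Fin b → Step b
  east  : Step b

Point : Set
Point = ℕ × ℕ

Path : ℕ → Set
Path b = List (Step b × Point)

eastRun : ∀ {b} → ℕ → ℕ → ℕ → Path b
eastRun y x zero    = []
eastRun y x (suc n) = (east , (suc x , y)) ∷ eastRun y (suc x) n

-- current height y, current x-coordinate cx, remaining (w_t , x_t), target width a
pathFrom : ∀ {b} → ℕ → ℕ → List (Fin b × ℕ) → ℕ → Path b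
pathFrom y cx [] a = if does (cx ≤? a) then eastRun y cx (a ∸ cx) else []
pathFrom y cx ((w , x) ∷ rest) a =
  eastRun y cx (x ∸ cx) ++ ((north w , (x , suc y)) ∷ pathFrom (suc y) x rest a)

-- lpath(D) (for D ≥ 0, so x_t = ∣ D(w_t) ∣ = D(w_t)), starting at (0,0).
lpath : (a : ℕ) {b : ℕ} → Config b → Path b
lpath a D = pathFrom 0 0 (map (λ w → (w , ∣ D w ∣)) (poorToRich D)) a

vmin : (a b : ℕ) .{{_ : NonZero b}} → ℕ → Point
vmin a b s with does (s <? b)
... | Data.Bool.true  = ((s ℕ.* a) / b , s)
... | Data.Bool.false = (a ∸ 1 , b)

EastInto : ∀ {b} → Path b → Point → Set
EastInto Q v = (east , v) ∈ Q

{-# OPTIONS --safe #-}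
module Submission where

-- Suppose β_T is legal on D and β_T(D) is k-stable, and put t = |T|, c = ⌊ta/b⌋. Stability
-- against single-vertex firings bounds every value of β_T(D) by ⌊(b-1)a/b⌋ < a, and
-- ⌊ta/b⌋ + ⌊(b-t)a/b⌋ ≥ a - 1; so every i ∈ T has D(i) < c, while legality of β_T gives
-- D(i) ≥ c for i ∉ T. Hence T is exactly the set of the t poorest vertices, and lpath(D)
-- crosses the vertical line x = c at height t by an east step, i.e. enters v_t from the west.
-- For t = b all values are at most a - 2, and the final east run passes through v_b = (a-1, b).
-- Since there are finitely many T, failure of skeletality produces such a T.

open import Defs
open import Level using (0ℓ)
open import Function using (_∘_; _⇔_; mk⇔; Equivalence)
open import Data.Bool using (true; false; if_then_else_)
open import Data.Empty using (⊥-elim)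
open import Data.Product using (_×_; _,_; proj₁; proj₂; ∃-syntax; Σ-syntax)
open import Data.Sum using (inj₁; inj₂)
open import Data.Nat using (ℕ; zero; >-nonZero⁻¹; suc; _+_; _*_; _∸_; _<_; _≤_; _<?_; _≤?_; z≤n; s≤s; NonZero)
import Data.Nat.Properties as ℕP
open import Data.Nat.DivMod using (_/_; _%_; m≡m%n+[m/n]*n; m%n<n; m<n*o⇒m/o<n; 0/n≡0)
open import Data.Nat.Tactic.RingSolver using (solve-∀)
open import Data.Nat.Coprimality using (Coprime)
open import Data.Integer as ℤ using (ℤ; +_; ∣_∣)
import Data.Integer.Properties as ℤP
open import Data.Fin as F using (Fin)
import Data.Fin.Properties as FinP
open import Data.Fin.Subset as Sub using (Subset; inside; outside)
import Data.Fin.Subset.Properties as SubP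
open import Data.Vec as V using (lookup)
import Data.Vec.Properties as VP
open import Data.List as L using (List; []; _∷_; _++_; map; take; length; filter; takeWhile; dropWhile; allFin)
import Data.List.Properties as LP
open import Data.List.Relation.Unary.All as All using (All; []; _∷_)
import Data.List.Relation.Unary.All.Properties as AllP
open import Data.List.Relation.Unary.AllPairs as AllPairs using (AllPairs; []; _∷_)
import Data.List.Relation.Unary.AllPairs.Properties as AllPairsP
import Data.List.Relation.Unary.Linked.Properties as LinkedP
open import Data.List.Relation.Unary.Any using (here; there)
open import Data.List.Membership.Propositional using (_∈_)
import Data.List.Membership.Propositional.Properties as ∈P
open import Data.List.Relation.Binary.Permutation.Propositional using (_↭_; ↭-sym)
import Data.List.Relation.Binary.Permutation.Propositional.Properties as ↭P
open import Relation.Binary using (Rel)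
open import Relation.Binary.Bundles using (DecTotalOrder)
open import Relation.Binary.PropositionalEquality
  using (_≡_; refl; sym; trans; cong; cong₂; subst; subst₂; module ≡-Reasoning)
open import Relation.Nullary using (¬_; Dec; yes; no; does)
open import Relation.Nullary.Decidable using (_×-dec_; dec-true; dec-false)
open import Relation.Unary using (Pred; Decidable; ∁)

∣tabulate∣≡length∘filter : ∀ {n} {A : Set} {P : Pred A 0ℓ} (P? : Decidable P) (f : Fin n → A) →
  Sub.∣ V.tabulate (does ∘ P? ∘ f) ∣ ≡ length (filter P? (L.tabulate f))
∣tabulate∣≡length∘filter {zero}  P? f = refl
∣tabulate∣≡length∘filter {suc n} P? f with does (P? (f F.zero))
... | true  = cong suc (∣tabulate∣≡length∘filter P? (f ∘ F.suc))
... | false = ∣tabulate∣≡length∘filter P? (f ∘ F.suc)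

x∈p⇒0<∣p∣ : ∀ {n} {x : Fin n} {p : Subset n} → x Sub.∈ p → 0 < Sub.∣ p ∣
x∈p⇒0<∣p∣ {x = x} {p} x∈p = subst (_≤ Sub.∣ p ∣) (SubP.∣⁅x⁆∣≡1 x)
  (SubP.p⊆q⇒∣p∣≤∣q∣ (λ y∈⁅x⁆ → subst (Sub._∈ p) (sym (SubP.x∈⁅y⁆⇒x≡y x y∈⁅x⁆)) x∈p))

take-length-++ : ∀ {A : Set} (xs ys : List A) → take (length xs) (xs ++ ys) ≡ xs
take-length-++ []       ys = refl
take-length-++ (x ∷ xs) ys = cong (x ∷_) (take-length-++ xs ys)

module _ {A : Set} {R : Rel A 0ℓ} {P : Pred A 0ℓ} (P? : Decidable P)
         (P-downClosed : ∀ {x y} → R x y → P y → P x) where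

  AllPairs⇒All∁-dropWhile : ∀ {xs} → AllPairs R xs → All (∁ P) (dropWhile P? xs)
  AllPairs⇒All∁-dropWhile {x ∷ xs} (x≤xs ∷ sorted) with P? x
  ... | yes _  = AllPairs⇒All∁-dropWhile sorted
  ... | no ¬px = ¬px ∷ All.map (λ x≤y py → ¬px (P-downClosed x≤y py)) x≤xs
  AllPairs⇒All∁-dropWhile {[]} [] = []

  AllPairs⇒filter≡takeWhile : ∀ {xs} → AllPairs R xs → filter P? xs ≡ takeWhile P? xs
  AllPairs⇒filter≡takeWhile {xs} sorted = begin
    filter P? xs                                                ≡⟨ cong (filter P?) (sym (LP.takeWhile++dropWhile P? xs)) ⟩
    filter P? (takeWhile P? xs ++ dropWhile P? xs)              ≡⟨ LP.filter-++ P? (takeWhile P? xs) (dropWhile P? xs) ⟩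
    filter P? (takeWhile P? xs) ++ filter P? (dropWhile P? xs)  ≡⟨ cong₂ _++_ (LP.filter-all P? (AllP.all-takeWhile P? xs))
                                                                            (LP.filter-none P? (AllPairs⇒All∁-dropWhile sorted)) ⟩
    takeWhile P? xs ++ []                                       ≡⟨ LP.++-identityʳ _ ⟩
    takeWhile P? xs                                             ∎
    where open ≡-Reasoning

pred[n]<n : ∀ n .{{_ : NonZero n}} → n ∸ 1 < n
pred[n]<n n = ℕP.m≤pred[n]⇒suc[m]≤n ℕP.≤-refl

[b∸1]*a/b<a : ∀ a b .{{_ : NonZero a}} .{{_ : NonZero b}} → (b ∸ 1) * a / b < a
[b∸1]*a/b<a a b = m<n*o⇒m/o<n (begin-strict
  (b ∸ 1) * a  <⟨ ℕP.*-monoˡ-< a (pred[n]<n b) ⟩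
  b * a        ≡⟨ ℕP.*-comm b a ⟩
  a * b        ∎)
  where open ℕP.≤-Reasoning

a≤1+x/b+y/b : ∀ a b x y .{{_ : NonZero b}} → x + y ≡ a * b → a ≤ suc (x / b + y / b)
a≤1+x/b+y/b a b x y x+y≡ab = ℕP.≤-pred (ℕP.*-cancelʳ-< b a (2 + (x / b + y / b)) (begin-strict
  a * b                                    ≡⟨ sym x+y≡ab ⟩
  x + y                                    ≡⟨ cong₂ _+_ (m≡m%n+[m/n]*n x b) (m≡m%n+[m/n]*n y b) ⟩
  (x % b + x / b * b) + (y % b + y / b * b) <⟨ ℕP.+-mono-<-≤ (ℕP.+-monoˡ-< (x / b * b) (m%n<n x b))
                                                             (ℕP.+-monoˡ-≤ (y / b * b) (ℕP.<⇒≤ (m%n<n y b))) ⟩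
  (b + x / b * b) + (b + y / b * b)        ≡⟨ distrib b (x / b) (y / b) ⟩
  (2 + (x / b + y / b)) * b                ∎))
  where
  open ℕP.≤-Reasoning
  distrib : ∀ b p q → (b + p * b) + (b + q * b) ≡ (2 + (p + q)) * b
  distrib = solve-∀

a≤1+⌊ta/b⌋+⌊[b∸t]a/b⌋ : ∀ a b t .{{_ : NonZero b}} → t ≤ b → a ≤ suc (t * a / b + (b ∸ t) * a / b)
a≤1+⌊ta/b⌋+⌊[b∸t]a/b⌋ a b t t≤b = a≤1+x/b+y/b a b (t * a) ((b ∸ t) * a) (begin
  t * a + (b ∸ t) * a  ≡⟨ sym (ℕP.*-distribʳ-+ a t (b ∸ t)) ⟩
  (t + (b ∸ t)) * a    ≡⟨ cong (_* a) (ℕP.m+[n∸m]≡n t≤b) ⟩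
  b * a                ≡⟨ ℕP.*-comm b a ⟩
  a * b                ∎)
  where open ≡-Reasoning

xAfter : ∀ {b} → ℕ → List (Fin b × ℕ) → ℕ
xAfter cx []             = cx
xAfter cx ((_ , x) ∷ ps) = xAfter x ps

xAfter-< : ∀ {b} {cx j} {ps : List (Fin b × ℕ)} → cx < j → All (λ p → proj₂ p < j) ps → xAfter cx ps < j
xAfter-< cx<j []           = cx<j
xAfter-< cx<j (x<j ∷ ps<j) = xAfter-< x<j ps<j

eastRun-∋ : ∀ {b} y x n {j} → x < j → j ≤ x + n → (east , (j , y)) ∈ eastRun {b} y x n
eastRun-∋ y x zero    {j} x<j j≤x+0 = ⊥-elim (ℕP.<⇒≱ x<j (subst (j ≤_) (ℕP.+-identityʳ x) j≤x+0))
eastRun-∋ y x (suc n) {j} x<j j≤x+1+n with ℕP.m≤n⇒m<n∨m≡n x<j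
... | inj₂ refl = here refl
... | inj₁ 1+x<j = there (eastRun-∋ y (suc x) n 1+x<j (subst (j ≤_) (ℕP.+-suc x n) j≤x+1+n))

pathFrom-++⁺ : ∀ {b} a y cx (ps qs : List (Fin b × ℕ)) {e} →
  e ∈ pathFrom (y + length ps) (xAfter cx ps) qs a → e ∈ pathFrom y cx (ps ++ qs) a
pathFrom-++⁺ a y cx []             qs {e} e∈ = subst (λ y′ → e ∈ pathFrom y′ cx qs a) (ℕP.+-identityʳ y) e∈
pathFrom-++⁺ a y cx ((w , x) ∷ ps) qs {e} e∈ = ∈P.∈-++⁺ʳ (eastRun y cx (x ∸ cx)) (there
  (pathFrom-++⁺ a (suc y) x ps qs (subst (λ y′ → e ∈ pathFrom y′ (xAfter x ps) qs a) (ℕP.+-suc y (length ps)) e∈)))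

pathFrom-east-between : ∀ {b} a y cx (ps : List (Fin b × ℕ)) w x qs {j} →
  xAfter cx ps < j → j ≤ x → (east , (j , y + length ps)) ∈ pathFrom y cx (ps ++ (w , x) ∷ qs) a
pathFrom-east-between a y cx ps w x qs {j} x′<j j≤x = pathFrom-++⁺ a y cx ps ((w , x) ∷ qs)
  (∈P.∈-++⁺ˡ (eastRun-∋ _ x′ (x ∸ x′) x′<j (subst (j ≤_) (sym (ℕP.m+[n∸m]≡n (ℕP.<⇒≤ (ℕP.<-≤-trans x′<j j≤x)))) j≤x)))
  where
  x′ : ℕ
  x′ = xAfter cx ps

pathFrom-east-end : ∀ {b} a y cx (ps : List (Fin b × ℕ)) {j} →
  xAfter cx ps < j → j ≤ a → (east , (j , y + length ps)) ∈ pathFrom y cx ps a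
pathFrom-east-end a y cx ps {j} x′<j j≤a =
  subst (λ qs → (east , (j , y + length ps)) ∈ pathFrom y cx qs a) (LP.++-identityʳ ps) (pathFrom-++⁺ a y cx ps [] final)
  where
  x′ : ℕ
  x′ = xAfter cx ps
  x′≤a : x′ ≤ a
  x′≤a = ℕP.<⇒≤ (ℕP.<-≤-trans x′<j j≤a)
  final : (east , (j , y + length ps)) ∈ pathFrom (y + length ps) x′ [] a
  final rewrite dec-true (x′ ≤? a) x′≤a =
    eastRun-∋ _ x′ (a ∸ x′) x′<j (subst (j ≤_) (sym (ℕP.m+[n∸m]≡n x′≤a)) j≤a)

module PoorToRich {b} (D : Config b) where
  open import Data.List.Sort (lexOrder b) using (sort; sort-↭; sort-↗)
  open DecTotalOrder (lexOrder b) using () renaming (_≤_ to _≤ₗₑₓ_; trans to ≤ₗₑₓ-trans)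

  labelled : Fin b → ℤ × Fin b
  labelled i = (D i , i)

  sort≡map-labelled : sort (map labelled (allFin b)) ≡ map labelled (poorToRich D)
  sort≡map-labelled = begin
    sort xs                                ≡⟨ sym (LP.map-id-local (All.tabulate (is-labelled ∘ ∈P.∈-map⁻ labelled ∘ ↭P.∈-resp-↭ (sort-↭ xs)))) ⟩
    map (labelled ∘ proj₂) (sort xs)       ≡⟨ LP.map-∘ (sort xs) ⟩
    map labelled (map proj₂ (sort xs))     ∎
    where
    open ≡-Reasoning
    xs : List (ℤ × Fin b)
    xs = map labelled (allFin b)
    is-labelled : ∀ {p} → ∃[ i ] (i ∈ allFin b × p ≡ labelled i) → labelled (proj₂ p) ≡ p
    is-labelled (i , _ , refl) = refl

  poorToRich-↭ : poorToRich D ↭ allFin b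
  poorToRich-↭ = subst (poorToRich D ↭_) (trans (sym (LP.map-∘ (allFin b))) (LP.map-id (allFin b)))
    (↭P.map⁺ proj₂ (sort-↭ (map labelled (allFin b))))

  ∈-poorToRich : ∀ i → i ∈ poorToRich D
  ∈-poorToRich i = ↭P.∈-resp-↭ (↭-sym poorToRich-↭) (∈P.∈-allFin i)

  length-poorToRich : length (poorToRich D) ≡ b
  length-poorToRich = trans (↭P.↭-length poorToRich-↭) (LP.length-tabulate (λ i → i))

  poorToRich-sorted : AllPairs (λ i j → D i ℤ.≤ D j) (poorToRich D)
  poorToRich-sorted = AllPairs.map lex⇒≤ (AllPairsP.map⁻
    (subst (AllPairs _≤ₗₑₓ_) sort≡map-labelled (LinkedP.Linked⇒AllPairs ≤ₗₑₓ-trans (sort-↗ _))))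
    where
    lex⇒≤ : ∀ {i j} → labelled i ≤ₗₑₓ labelled j → D i ℤ.≤ D j
    lex⇒≤ (inj₁ (Di≤Dj , _)) = Di≤Dj
    lex⇒≤ (inj₂ (Di≡Dj , _)) = ℤP.≤-reflexive Di≡Dj

  level : Fin b → Fin b × ℕ
  level w = (w , ∣ D w ∣)

  lpath-east-between : ∀ a ps w qs {j} → poorToRich D ≡ ps ++ w ∷ qs → 0 < j →
    All (λ i → ∣ D i ∣ < j) ps → j ≤ ∣ D w ∣ → EastInto (lpath a D) (j , length ps)
  lpath-east-between a ps w qs {j} split 0<j ps<j j≤w =
    subst (λ K → (east , (j , length ps)) ∈ pathFrom 0 0 (map level K) a) (sym split) east-on-split
    where
    east-on-split : (east , (j , length ps)) ∈ pathFrom 0 0 (map level (ps ++ w ∷ qs)) a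
    east-on-split rewrite LP.map-++ level ps (w ∷ qs) | sym (LP.length-map level ps) =
      pathFrom-east-between a 0 0 (map level ps) w _ (map level qs) (xAfter-< 0<j (AllP.map⁺ ps<j)) j≤w

  lpath-east-end : ∀ a {j} → 0 < j → (∀ i → ∣ D i ∣ < j) → j ≤ a → EastInto (lpath a D) (j , b)
  lpath-east-end a {j} 0<j all<j j≤a =
    subst (λ y → (east , (j , y)) ∈ lpath a D) (trans (LP.length-map level (poorToRich D)) length-poorToRich)
      (pathFrom-east-end a 0 0 (map level (poorToRich D))
        (xAfter-< 0<j (AllP.map⁺ (All.universal all<j (poorToRich D)))) j≤a)

module Threshold {b} (D : Config b) (D≥0 : NonNeg D) (c : ℕ) where
  open PoorToRich D
  open import Data.List.Membership.DecPropositional (FinP._≟_ {b}) using (_∈?_)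

  Below : Pred (Fin b) 0ℓ
  Below i = ∣ D i ∣ < c

  below? : Decidable Below
  below? i = ∣ D i ∣ <? c

  below : Subset b
  below = V.tabulate (does ∘ below?)

  poorer richer : List (Fin b)
  poorer = takeWhile below? (poorToRich D)
  richer = dropWhile below? (poorToRich D)

  poorToRich-split : poorToRich D ≡ poorer ++ richer
  poorToRich-split = sym (LP.takeWhile++dropWhile below? (poorToRich D))

  sorted : AllPairs (λ i j → ∣ D i ∣ ≤ ∣ D j ∣) (poorToRich D)
  sorted = AllPairs.map (λ {i} {j} → ℤP.drop‿+≤+ ∘ subst₂ ℤ._≤_ (+∣D∣≡D i) (+∣D∣≡D j)) poorToRich-sorted
    where
    +∣D∣≡D : ∀ i → D i ≡ + ∣ D i ∣
    +∣D∣≡D i = sym (ℤP.0≤i⇒+∣i∣≡i (D≥0 i))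

  poorer-below : All Below poorer
  poorer-below = AllP.all-takeWhile below? (poorToRich D)

  richer-above : All (∁ Below) richer
  richer-above = AllPairs⇒All∁-dropWhile below? ℕP.≤-<-trans sorted

  ∈-poorer⇔below : ∀ {i} → i ∈ poorer ⇔ Below i
  ∈-poorer⇔below {i} = mk⇔ (All.lookup poorer-below) in-poorer
    where
    in-poorer : Below i → i ∈ poorer
    in-poorer i-below with ∈P.∈-++⁻ poorer (subst (i ∈_) poorToRich-split (∈-poorToRich i))
    ... | inj₁ i∈poorer = i∈poorer
    ... | inj₂ i∈richer = ⊥-elim (All.lookup richer-above i∈richer i-below)

  length-poorer : length poorer ≡ Sub.∣ below ∣
  length-poorer = begin
    length poorer                          ≡⟨ cong length (sym (AllPairs⇒filter≡takeWhile below? ℕP.≤-<-trans sorted)) ⟩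
    length (filter below? (poorToRich D))  ≡⟨ ↭P.↭-length (↭P.filter-↭ below? poorToRich-↭) ⟩
    length (filter below? (allFin b))      ≡⟨ sym (∣tabulate∣≡length∘filter below? (λ i → i)) ⟩
    Sub.∣ below ∣                          ∎
    where open ≡-Reasoning

  poorest-below : poorest Sub.∣ below ∣ D ≡ below
  poorest-below = VP.tabulate-cong pointwise
    where
    take-poorer : take Sub.∣ below ∣ (poorToRich D) ≡ poorer
    take-poorer = begin
      take Sub.∣ below ∣ (poorToRich D)       ≡⟨ cong₂ take (sym length-poorer) poorToRich-split ⟩
      take (length poorer) (poorer ++ richer) ≡⟨ take-length-++ poorer richer ⟩
      poorer                                  ∎
      where open ≡-Reasoning
    pointwise : ∀ i → (if does (i ∈? take Sub.∣ below ∣ (poorToRich D)) then inside else outside) ≡ does (below? i)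
    pointwise i rewrite take-poorer with i ∈? poorer
    ... | yes i∈poorer = sym (dec-true (below? i) (Equivalence.to ∈-poorer⇔below i∈poorer))
    ... | no  i∉poorer = sym (dec-false (below? i) (i∉poorer ∘ Equivalence.from ∈-poorer⇔below))

  lpath-east-threshold : ∀ a → 0 < length poorer → length poorer < b → EastInto (lpath a D) (c , length poorer)
  lpath-east-threshold a 0<ℓ ℓ<b with poorer | poorer-below | richer | richer-above | poorToRich-split
  ... | u ∷ ps | u<c ∷ ps<c | w ∷ rs | w≮c ∷ _ | split =
    lpath-east-between a (u ∷ ps) w rs split (ℕP.≤-<-trans z≤n u<c) (u<c ∷ ps<c) (ℕP.≮⇒≥ w≮c)
  ... | ps | _ | [] | _ | split = ⊥-elim (ℕP.<⇒≢ ℓ<b (begin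
    length ps         ≡⟨ cong length (sym (LP.++-identityʳ ps)) ⟩
    length (ps ++ []) ≡⟨ cong length (sym split) ⟩
    length (poorToRich D) ≡⟨ length-poorToRich ⟩
    b                 ∎))
    where open ≡-Reasoning

module Moves (a b : ℕ) .{{_ : NonZero b}} where

  β-inside : ∀ S D i → lookup S i ≡ inside → β a b S D i ≡ D i ℤ.+ + suc ((b ∸ Sub.∣ S ∣) * a / b)
  β-inside S D i i∈S with lookup S i | i∈S
  ... | .inside | refl = refl

  β-outside : ∀ S D i → lookup S i ≡ outside → β a b S D i ≡ D i ℤ.- + (Sub.∣ S ∣ * a / b)
  β-outside S D i i∉S with lookup S i | i∉S
  ... | .outside | refl = refl

  KStable⇒≤⌊[b∸1]a/b⌋ : ∀ {k E} → KStable a b k E → ∀ i → ∣ E i ∣ ≤ (b ∸ 1) * a / b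
  KStable⇒≤⌊[b∸1]a/b⌋ {k} {E} (E≥0 , stable) i with ∣ E i ∣ ≤? (b ∸ 1) * a / b
  ... | yes Ei≤ = Ei≤
  ... | no  Ei≰ = ⊥-elim (stable ⁅i⁆ (subst (0 <_) (sym ∣⁅i⁆∣≡1) (s≤s z≤n)) (subst (_≤ suc k) (sym ∣⁅i⁆∣≡1) (s≤s z≤n)) legal)
    where
    ⁅i⁆ : Subset b
    ⁅i⁆ = Sub.⁅ i ⁆
    ∣⁅i⁆∣≡1 : Sub.∣ ⁅i⁆ ∣ ≡ 1
    ∣⁅i⁆∣≡1 = SubP.∣⁅x⁆∣≡1 i
    legal : NonNeg (φ a b ⁅i⁆ E)
    legal j with lookup ⁅i⁆ j in j∈?
    ... | inside rewrite ∣⁅i⁆∣≡1 | SubP.x∈⁅y⁆⇒x≡y i (VP.lookup⇒[]= j ⁅i⁆ j∈?) | sym (ℤP.0≤i⇒+∣i∣≡i (E≥0 i)) =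
      ℤP.i≤j⇒0≤j-i (ℤ.+≤+ (ℕP.≰⇒> Ei≰))
    ... | outside = ℤP.≤-trans (E≥0 j) (ℤP.i≤i+j (E j) _)

vmin-< : ∀ a b .{{_ : NonZero b}} {s} → s < b → vmin a b s ≡ (s * a / b , s)
vmin-< a b {s} s<b rewrite dec-true (s <? b) s<b = refl

vmin-b : ∀ a b .{{_ : NonZero b}} → vmin a b b ≡ (a ∸ 1 , b)
vmin-b a b rewrite dec-false (b <? b) (ℕP.n≮n b) = refl

module LegalStableβ (a b k : ℕ) .{{_ : NonZero a}} .{{_ : NonZero b}}
  (D : Config b) (D≥0 : NonNeg D) (T : Subset b) (0<∣T∣ : 0 < Sub.∣ T ∣)
  (legal : NonNeg (β a b T D)) (stable : KStable a b k (β a b T D)) where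
  open Moves a b

  t c : ℕ
  t = Sub.∣ T ∣
  c = t * a / b

  open Threshold D D≥0 c

  d : Fin b → ℕ
  d i = ∣ D i ∣

  +∣D∣≡D : ∀ i → + d i ≡ D i
  +∣D∣≡D i = ℤP.0≤i⇒+∣i∣≡i (D≥0 i)

  inside-level : ∀ {i} → lookup T i ≡ inside → d i + suc ((b ∸ t) * a / b) < a
  inside-level {i} i∈T = ℕP.≤-<-trans (subst (_≤ _) ∣βD∣≡ (KStable⇒≤⌊[b∸1]a/b⌋ stable i)) ([b∸1]*a/b<a a b)
    where
    ∣βD∣≡ : ∣ β a b T D i ∣ ≡ d i + suc ((b ∸ t) * a / b)
    ∣βD∣≡ = cong ∣_∣ (trans (β-inside T D i i∈T) (cong (ℤ._+ _) (sym (+∣D∣≡D i))))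

  inside⇒below : ∀ {i} → lookup T i ≡ inside → d i < c
  inside⇒below {i} i∈T = ℕP.+-cancelʳ-≤ y (suc (d i)) c (ℕP.≤-pred (begin
    suc (suc (d i) + y)  ≡⟨ cong suc (sym (ℕP.+-suc (d i) y)) ⟩
    suc (d i + suc y)    ≤⟨ inside-level i∈T ⟩
    a                    ≤⟨ a≤1+⌊ta/b⌋+⌊[b∸t]a/b⌋ a b t (SubP.∣p∣≤n T) ⟩
    suc (c + y)          ∎))
    where
    open ℕP.≤-Reasoning
    y : ℕ
    y = (b ∸ t) * a / b

  outside⇒above : ∀ {i} → lookup T i ≡ outside → c ≤ d i
  outside⇒above {i} i∉T = ℤP.drop‿+≤+ (ℤP.0≤i-j⇒j≤i
    (subst (ℤ.0ℤ ℤ.≤_) (trans (β-outside T D i i∉T) (cong (ℤ._- _) (sym (+∣D∣≡D i)))) (legal i)))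

  T≡below : T ≡ below
  T≡below = trans (sym (VP.tabulate∘lookup T)) (VP.tabulate-cong pointwise)
    where
    pointwise : ∀ i → lookup T i ≡ does (below? i)
    pointwise i with lookup T i in i∈?T
    ... | inside  = sym (dec-true (below? i) (inside⇒below i∈?T))
    ... | outside = sym (dec-false (below? i) (ℕP.≤⇒≯ (outside⇒above i∈?T)))

  poorest-t≡T : poorest t D ≡ T
  poorest-t≡T = subst (λ S → poorest Sub.∣ S ∣ D ≡ S) (sym T≡below) poorest-below

  full⇒below-a∸1 : t ≡ b → ∀ i → d i < a ∸ 1
  full⇒below-a∸1 t≡b i = ℕP.suc[m]≤n⇒m≤pred[n] (subst (_< a) d+1≡1+d (inside-level i∈T))
    where
    i∈T : lookup T i ≡ inside
    i∈T rewrite SubP.∣p∣≡n⇒p≡⊤ {p = T} t≡b = VP.lookup-replicate i inside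
    [b∸t]a/b≡0 : (b ∸ t) * a / b ≡ 0
    [b∸t]a/b≡0 = trans (cong (λ u → (b ∸ u) * a / b) t≡b) (trans (cong (λ u → u * a / b) (ℕP.n∸n≡0 b)) (0/n≡0 b))
    d+1≡1+d : d i + suc ((b ∸ t) * a / b) ≡ suc (d i)
    d+1≡1+d = trans (cong (λ u → d i + suc u) [b∸t]a/b≡0) (ℕP.+-comm (d i) 1)

  east-into-vmin : EastInto (lpath a D) (vmin a b t)
  east-into-vmin with ℕP.m≤n⇒m<n∨m≡n (SubP.∣p∣≤n T)
  ... | inj₁ t<b = subst (λ v → EastInto (lpath a D) v) (sym (vmin-< a b t<b))
    (subst (λ s → EastInto (lpath a D) (c , s)) ℓ≡t
      (lpath-east-threshold a (subst (0 <_) (sym ℓ≡t) 0<∣T∣) (subst (_< b) (sym ℓ≡t) t<b)))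
    where
    ℓ≡t : length poorer ≡ t
    ℓ≡t = trans length-poorer (cong Sub.∣_∣ (sym T≡below))
  ... | inj₂ t≡b = subst (λ v → EastInto (lpath a D) v) (sym (trans (cong (vmin a b) t≡b) (vmin-b a b)))
    (PoorToRich.lpath-east-end D a 0<a∸1 (full⇒below-a∸1 t≡b) (ℕP.m∸n≤m a 1))
    where
    0<a∸1 : 0 < a ∸ 1
    0<a∸1 = ℕP.≤-<-trans z≤n (full⇒below-a∸1 t≡b (F.fromℕ< (>-nonZero⁻¹ b)))

∈-take-nonempty : ∀ {A : Set} (xs : List A) {s} → 0 < s → 0 < length xs → ∃[ x ] x ∈ take s xs
∈-take-nonempty (x ∷ xs) {suc s} _ _ = x , here refl

poorest-nonempty : ∀ {b} .{{_ : NonZero b}} (D : Config b) {s} → 0 < s → 0 < Sub.∣ poorest s D ∣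
poorest-nonempty {b} D {s} 0<s with ∈-take-nonempty (poorToRich D) 0<s
  (subst (0 <_) (sym (PoorToRich.length-poorToRich D)) (>-nonZero⁻¹ b))
... | w , w∈take = x∈p⇒0<∣p∣ (VP.lookup⇒[]= w (poorest s D)
  (trans (VP.lookup∘tabulate _ w) (cong (λ v → if v then inside else outside) (dec-true (w ∈? _) w∈take))))
  where open import Data.List.Membership.DecPropositional (FinP._≟_ {b}) using (_∈?_)

nonNeg? : ∀ {b} → Decidable (NonNeg {b})
nonNeg? E = FinP.all? (λ i → ℤ.0ℤ ℤP.≤? E i)

kStable? : ∀ a b .{{_ : NonZero b}} k → Decidable (KStable a b k)
kStable? a b k E = nonNeg? E ×-dec no-legal-firing?
  where
  no-legal-firing? : Dec (∀ S → 0 < Sub.∣ S ∣ → Sub.∣ S ∣ ≤ suc k → ¬ NonNeg (φ a b S E))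
  no-legal-firing? with SubP.anySubset? (λ S → (0 <? Sub.∣ S ∣) ×-dec (Sub.∣ S ∣ ≤? suc k) ×-dec nonNeg? (φ a b S E))
  ... | yes (S , 0<s , s≤k+1 , legal) = no (λ none → none S 0<s s≤k+1 legal)
  ... | no  ¬firing                    = yes (λ S 0<s s≤k+1 legal → ¬firing (S , 0<s , s≤k+1 , legal))

¬KSkeletal⇒legal-stable-β : ∀ a b .{{_ : NonZero b}} k {D} → KStable a b k D → ¬ KSkeletal a b k D →
  ∃[ T ] (0 < Sub.∣ T ∣ × NonNeg (β a b T D) × KStable a b k (β a b T D))
¬KSkeletal⇒legal-stable-β a b k {D} stable ¬skeletal
  with SubP.anySubset? (λ T → (0 <? Sub.∣ T ∣) ×-dec nonNeg? (β a b T D) ×-dec kStable? a b k (β a b T D))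
... | yes witness = witness
... | no  none    = ⊥-elim (¬skeletal (stable , λ T 0<t legal stable′ → none (T , 0<t , legal , stable′)))

PoorestInverseFiring : (a b : ℕ) .{{_ : NonZero b}} → ℕ → Config b → ℕ → Set
PoorestInverseFiring a b k D s = 1 ≤ s × s ≤ b × EastInto (lpath a D) (vmin a b s)
  × NonNeg (β a b (poorest s D) D) × KStable a b k (β a b (poorest s D) D)

¬KSkeletal⇒PoorestInverseFiring : ∀ a b .{{_ : NonZero a}} .{{_ : NonZero b}} k {D} → KStable a b k D →
  ¬ KSkeletal a b k D → Σ[ s ∈ ℕ ] PoorestInverseFiring a b k D s
¬KSkeletal⇒PoorestInverseFiring a b k {D} stable ¬skeletal
  with T , 0<t , legal , stableβ ← ¬KSkeletal⇒legal-stable-β a b k stable ¬skeletal =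
  t , 0<t , SubP.∣p∣≤n T , east-into-vmin ,
  subst (λ S → NonNeg (β a b S D)) (sym poorest-t≡T) legal ,
  subst (λ S → KStable a b k (β a b S D)) (sym poorest-t≡T) stableβ
  where open LegalStableβ a b k D (proj₁ stable) T 0<t legal stableβ

PoorestInverseFiring⇒¬KSkeletal : ∀ a b .{{_ : NonZero b}} k {D} →
  Σ[ s ∈ ℕ ] PoorestInverseFiring a b k D s → ¬ KSkeletal a b k D
PoorestInverseFiring⇒¬KSkeletal a b k {D} (s , 0<s , _ , _ , legal , stable) (_ , skeletal) =
  skeletal (poorest s D) (poorest-nonempty D 0<s) legal stable

lemma4p6 : (a b : ℕ) .{{_ : NonZero a}} .{{_ : NonZero b}} → Coprime a b →
    (k : ℕ) → k < b → (D : Config b) → KStable a b k D →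
    ((¬ KSkeletal a b k D) →
        Σ[ s ∈ ℕ ] (1 ≤ s × s ≤ b × EastInto (lpath a D) (vmin a b s)
          × NonNeg (β a b (poorest s D) D) × KStable a b k (β a b (poorest s D) D)))
    × ((Σ[ s ∈ ℕ ] (1 ≤ s × s ≤ b × EastInto (lpath a D) (vmin a b s)
          × NonNeg (β a b (poorest s D) D) × KStable a b k (β a b (poorest s D) D)))
        → ¬ KSkeletal a b k D)
lemma4p6 a b _ k _ D stable =
  ¬KSkeletal⇒PoorestInverseFiring a b k stable , PoorestInverseFiring⇒¬KSkeletal a b k
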